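{- In the basic bubble-up algorithm, let $x$ be an element, and let $C$ be the event that $x$ is a core element. The event $C$ is independent of the pair $(h_{d-1}(x), h_d(x))$.
   Context: A $d$-ary cuckoo hash table stores elements in an array of $n$ slots (each holding at most one element) using $d$ hash functions $h_1,\dots,h_d : U \to [n]$ that are fully independent and uniformly random; each stored element $x$ resides in one of $h_1(x),\dots,h_d(x)$. Elements are inserted one at a time. $\texttt{choice}(x)$ is the index $i$ with $x$ at $h_i(x)$ ($0$ if $x$ is not stored). The basic bubble-up algorithm inserts/re-places an element $x$ as follows: if $\texttt{choice}(x) = d$, move $x$ to $h_{d-1}(x)$, evicting any occupant; if $\texttt{choice}(x) = d-1$, move $x$ to $h_d(x)$, evicting any occupant; if $\texttt{choice}(x) < d-1$, sequentially check whether any of $h_{\texttt{choice}(x)+1}(x),\dots,h_{d-2}(x)$ is free and use the first free one found, otherwise move $x$ to $h_{d-1}(x)$, evicting any occupant. Evicted elements are re-placed by the same rule; failure is declared after $c\log n$ consecutive moves of the first two kinds without finding a free slot. An element $x$ is a core element if $\texttt{choice}(x) \in \{d-1,d\}$. -}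

module Defs where

open import Data.Nat using (ℕ; zero; suc; _+_; _*_; _≤_; _≤ᵇ_; _<ᵇ_)
open import Data.Fin using (Fin; toℕ; fromℕ; inject₁) renaming (_≟_ to _≟ᶠ_)
open import Data.Maybe using (Maybe; just; nothing)
open import Data.List using (List; []; _∷_; [_]; map; concatMap; filterᵇ; length; allFin)
open import Data.Bool using (Bool; true; false; _∧_; if_then_else_)
open import Relation.Nullary.Decidable using (does)

-- Conventions.
-- d = 2 + k (so d ≥ 2), universe U = Fin u, table slots Fin n.
-- A hash family is h : Fin (2 + k) → Fin u → Fin n, where the
-- 0-based index i : Fin (2 + k) stands for the paper's h_{i+1}.
-- The uniform, fully independent choice of h_1,…,h_d is the uniform
-- distribution on this finite set of functions (see allHash / count).

Hash : ℕ → ℕ → ℕ → Set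
Hash k u n = Fin (2 + k) → Fin u → Fin n

idx-d : ∀ k → Fin (2 + k)
idx-d k = fromℕ (suc k)

idx-d-1 : ∀ k → Fin (2 + k)
idx-d-1 k = inject₁ (fromℕ k)

-- State: the table (occupant of each slot) and choice(y)
-- (nothing = choice 0; just i = choice i+1).  An evicted element that
-- is waiting to be re-placed keeps its old choice value, as in the
-- bubble-up rule, which reads choice of the evicted element.
record State (k u n : ℕ) : Set where
  constructor st
  field
    table  : Fin n → Maybe (Fin u)
    choice : Fin u → Maybe (Fin (2 + k))
open State public

emptyState : ∀ {k u n} → State k u n
emptyState = st (λ _ → nothing) (λ _ → nothing)

put : ∀ {k u n} → State k u n → Fin u → Fin n → Fin (2 + k) → State k u n
put σ y s i =
  st (λ t → if does (t ≟ᶠ s) then just y else table σ t)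
     (λ z → if does (z ≟ᶠ y) then just i else choice σ z)

data Outcome (k u n : ℕ) : Set where
  ok   : State k u n → Outcome k u n
  fail : State k u n → Outcome k u n

data Kind (k : ℕ) : Set where
  kind-d   : Kind k
  kind-d-1 : Kind k
  kind-low : ℕ → Kind k        -- choice = c < d-1 (argument: c)

classify : ∀ {k} → Maybe (Fin (2 + k)) → Kind k
classify nothing = kind-low 0
classify {k} (just i) =
  if toℕ i Data.Nat.≡ᵇ suc k then kind-d
  else if toℕ i Data.Nat.≡ᵇ k then kind-d-1
  else kind-low (suc (toℕ i))

-- first free slot among h_{c+1}(y),…,h_{d-2}(y)  (1-based), i.e. 0-based
-- indices j with c ≤ j < k, scanned in increasing order
firstFree : ∀ {k u n} → Hash k u n → State k u n → Fin u → ℕ → List (Fin (2 + k)) → Maybe (Fin (2 + k))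
firstFree h σ y c [] = nothing
firstFree {k} h σ y c (j ∷ js) with (c ≤ᵇ toℕ j) ∧ (toℕ j <ᵇ k) | table σ (h j y)
... | true  | nothing = just j
... | _     | _       = firstFree h σ y c js

-- re-place y.  cnt = number of consecutive moves of the first two kinds
-- that found no free slot; failure once it reaches L.  The outer fuel is
-- a technical device for structural recursion; it is chosen large enough
-- (see insertOne) that it never runs out.
mutual
  replace : ∀ {k u n} (L fuel : ℕ) → Hash k u n → State k u n → Fin u → ℕ → Outcome k u n
  replace L zero h σ y cnt = fail σ
  replace {k} L (suc f) h σ y cnt with classify {k} (choice σ y)
  ... | kind-d   = moveCore L f h σ y (idx-d-1 k) cnt
  ... | kind-d-1 = moveCore L f h σ y (idx-d k) cnt
  ... | kind-low c with firstFree h σ y c (allFin (2 + k))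
  ...   | just j  = ok (put σ y (h j y) j)
  ...   | nothing with table σ (h (idx-d-1 k) y)
  ...     | nothing = ok (put σ y (h (idx-d-1 k) y) (idx-d-1 k))
  ...     | just z  = replace L f h (put σ y (h (idx-d-1 k) y) (idx-d-1 k)) z 0

  moveCore : ∀ {k u n} (L fuel : ℕ) → Hash k u n → State k u n → Fin u → Fin (2 + k) → ℕ → Outcome k u n
  moveCore L f h σ y i cnt with table σ (h i y)
  ... | nothing = ok (put σ y (h i y) i)
  ... | just z  = if L ≤ᵇ suc cnt
                  then fail (put σ y (h i y) i)
                  else replace L f h (put σ y (h i y) i) z (suc cnt)

insertOne : ∀ {k u n} (L : ℕ) → Hash k u n → State k u n → Fin u → Outcome k u n
insertOne {u = u} L h σ y = replace L (suc (suc u * suc (suc L))) h σ y 0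

insertFrom : ∀ {k u n} (L : ℕ) → Hash k u n → Outcome k u n → List (Fin u) → Outcome k u n
insertFrom L h (fail σ) ys       = fail σ
insertFrom L h (ok σ)   []       = ok σ
insertFrom L h (ok σ)   (y ∷ ys) = insertFrom L h (insertOne L h σ y) ys

insertAll : ∀ {k u n} (L : ℕ) → Hash k u n → List (Fin u) → Outcome k u n
insertAll L h ys = insertFrom L h (ok emptyState) ys

stateOf : ∀ {k u n} → Outcome k u n → State k u n
stateOf (ok σ) = σ
stateOf (fail σ) = σ

-- x is a core element: choice(x) ∈ {d-1, d}
isCoreᵇ : ∀ {k u n} → State k u n → Fin u → Bool
isCoreᵇ {k} σ x with choice σ x
... | nothing = false
... | just i  = k ≤ᵇ toℕ i

allFuns : ∀ {A : Set} (m : ℕ) → List A → List (Fin m → A)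
allFuns zero xs = [ (λ ()) ]
allFuns (suc m) xs = concatMap (λ a → map (λ f → cons a f) (allFuns m xs)) xs
  where
  cons : _ → (Fin m → _) → Fin (suc m) → _
  cons a f Fin.zero = a
  cons a f (Fin.suc i) = f i

allHash : ∀ k u n → List (Hash k u n)
allHash k u n = allFuns (2 + k) (allFuns u (allFin n))

count : ∀ k u n → (Hash k u n → Bool) → ℕ
count k u n p = length (filterᵇ p (allHash k u n))

eqFᵇ : ∀ {n} → Fin n → Fin n → Bool
eqFᵇ a b = does (a ≟ᶠ b)

-- the event C: after inserting xs (process halted at failure, if any),
-- x is a core element
coreEvent : ∀ k u n (L : ℕ) → List (Fin u) → Fin u → Hash k u n → Bool
coreEvent k u n L xs x h = isCoreᵇ (stateOf (insertAll L h xs)) x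

pairEvent : ∀ k u n → Fin u → Fin n → Fin n → Hash k u n → Bool
pairEvent k u n x a b h = eqFᵇ (h (idx-d-1 k) x) a ∧ eqFᵇ (h (idx-d k) x) b

-- Call two hash families x-equivalent if they differ at most in h_{d-1}(x) and h_d(x).
-- Runs of the insertion process under x-equivalent families coincide as long as x is
-- not a core element: re-placing an element y ≠ x only reads the hash values of y, and
-- x itself only reads h_1(x), …, h_{d-2}(x) until it overflows into h_{d-1}(x), where
-- it becomes core in both runs.  A core element stays core for ever, since from then on
-- it only moves between h_{d-1} and h_d.  So C is a function of the hash values other
-- than (h_{d-1}(x), h_d(x)), and since that pair is uniform and independent of the rest,
-- fixing it to (a, b) divides the number of families in C by exactly n².  Applying this
-- to C and to the sure event gives the product formula.

module Submission where

open import Defs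
open import Data.Nat using (ℕ; zero; suc; _+_; _*_; _≤_; _<_; _≡ᵇ_; _≤ᵇ_; _<ᵇ_)
open import Data.Nat.Properties
  using ( _≟_; +-assoc; +-identityʳ; *-zeroʳ; *-distribˡ-+; *-assoc; *-comm
        ; ≡⇒≡ᵇ; ≤⇒≤ᵇ; ≤ᵇ⇒≤; <ᵇ⇒<; ≤-reflexive; ≤-trans; ≤-antisym; ≤-pred
        ; ≤∧≢⇒<; ≰⇒>; <⇒≢; <⇒≱; m<n⇒m<1+n; n≤1+n)
open import Data.Fin using (Fin; toℕ; fromℕ) renaming (_≟_ to _≟ᶠ_)
open import Data.Fin.Properties using (toℕ<n; toℕ-fromℕ; toℕ-inject₁; fromℕ≢inject₁)
open import Data.Maybe using (just; nothing)
open import Data.Maybe.Properties using (just-injective)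
open import Data.List
  using (List; []; _∷_; _++_; map; concatMap; filterᵇ; length; allFin; tabulate)
open import Data.List.Properties using (map-tabulate; length-tabulate)
open import Data.List.Relation.Unary.Unique.Propositional using (Unique)
open import Data.Bool using (Bool; true; false; T; _∧_)
open import Data.Bool.Properties using (T-≡)
open import Data.Empty using (⊥-elim)
open import Data.Product using (_×_; _,_; ∃-syntax)
open import Data.Sum using (_⊎_; inj₁; inj₂; [_,_]′)
open import Data.Vec.Functional using (Vector; updateAt) renaming (_∷_ to _∷ᶠ_)
open import Data.Vec.Functional.Properties using (updateAt-updates; updateAt-minimal)
open import Data.Vec.Functional.Relation.Binary.Pointwise using (Pointwise)
open import Function using (_∘_; id; const; flip)
open import Function.Bundles using (Equivalence)
open import Relation.Binary.Core using (_Preserves_⟶_)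
open import Relation.Binary.Definitions using (Reflexive)
open import Relation.Nullary using (¬_; yes; no; contradiction)
open import Relation.Nullary.Decidable using (dec-false)
open import Relation.Binary.PropositionalEquality
open ≡-Reasoning

private
  variable
    A B C : Set
    k u n : ℕ

sumOver : List B → (B → ℕ) → ℕ
sumOver []       g = 0
sumOver (b ∷ bs) g = g b + sumOver bs g

infix 5 sumOver
syntax sumOver L (λ b → e) = ∑[ b ∈ L ] e

sumOver-cong : ∀ (L : List B) {g g′ : B → ℕ} → (∀ b → g b ≡ g′ b) → sumOver L g ≡ sumOver L g′
sumOver-cong []      eq = refl
sumOver-cong (b ∷ L) eq = cong₂ _+_ (eq b) (sumOver-cong L eq)

sumOver-++ : ∀ (L L′ : List B) g → sumOver (L ++ L′) g ≡ sumOver L g + sumOver L′ g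
sumOver-++ []      L′ g = refl
sumOver-++ (b ∷ L) L′ g = trans (cong (g b +_) (sumOver-++ L L′ g)) (sym (+-assoc (g b) _ _))

sumOver-map : ∀ (f : B → C) L g → sumOver (map f L) g ≡ sumOver L (g ∘ f)
sumOver-map f []      g = refl
sumOver-map f (b ∷ L) g = cong (g (f b) +_) (sumOver-map f L g)

sumOver-concatMap : ∀ (f : B → List C) L g →
                    sumOver (concatMap f L) g ≡ ∑[ b ∈ L ] sumOver (f b) g
sumOver-concatMap f []      g = refl
sumOver-concatMap f (b ∷ L) g =
  trans (sumOver-++ (f b) (concatMap f L) g)
        (cong (sumOver (f b) g +_) (sumOver-concatMap f L g))

*-distribˡ-sumOver : ∀ c (L : List B) g → c * sumOver L g ≡ ∑[ b ∈ L ] c * g b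
*-distribˡ-sumOver c []      g = *-zeroʳ c
*-distribˡ-sumOver c (b ∷ L) g =
  trans (*-distribˡ-+ c (g b) _) (cong (c * g b +_) (*-distribˡ-sumOver c L g))

sumOver-const : ∀ (L : List B) m → (∑[ b ∈ L ] m) ≡ length L * m
sumOver-const []      m = refl
sumOver-const (b ∷ L) m = cong (m +_) (sumOver-const L m)

indicator : Bool → ℕ
indicator true  = 1
indicator false = 0

indicator-∧ : ∀ p q → indicator (p ∧ q) ≡ indicator p * indicator q
indicator-∧ true  q = sym (+-identityʳ (indicator q))
indicator-∧ false q = refl

[_≡ᶠ_] : Fin n → Fin n → ℕ
[ v ≡ᶠ a ] = indicator (eqFᵇ v a)

length-filterᵇ : ∀ (p : B → Bool) L → length (filterᵇ p L) ≡ ∑[ b ∈ L ] indicator (p b)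
length-filterᵇ p []      = refl
length-filterᵇ p (b ∷ L) with p b
... | true  = cong suc (length-filterᵇ p L)
... | false = length-filterᵇ p L

sumOver-allFin-suc : ∀ (g : Fin (suc n) → ℕ) →
                     sumOver (allFin (suc n)) g ≡ g Fin.zero + (∑[ i ∈ allFin n ] g (Fin.suc i))
sumOver-allFin-suc {n} g = cong (g Fin.zero +_) (begin
  sumOver (tabulate Fin.suc) g        ≡⟨ cong (λ L → sumOver L g) (map-tabulate id Fin.suc) ⟨
  sumOver (map Fin.suc (allFin n)) g  ≡⟨ sumOver-map Fin.suc (allFin n) g ⟩
  (∑[ i ∈ allFin n ] g (Fin.suc i))   ∎)

sumOver-pick : ∀ (a : Fin n) (g : Fin n → ℕ) → (∑[ i ∈ allFin n ] [ i ≡ᶠ a ] * g i) ≡ g a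
sumOver-pick {suc n} Fin.zero g = begin
  sumOver (allFin (suc n)) (λ i → [ i ≡ᶠ Fin.zero ] * g i)
    ≡⟨ sumOver-allFin-suc (λ i → [ i ≡ᶠ Fin.zero ] * g i) ⟩
  g Fin.zero + 0 + (∑[ i ∈ allFin n ] 0)
    ≡⟨ cong₂ _+_ (+-identityʳ _) (sumOver-const (allFin n) 0) ⟩
  g Fin.zero + length (allFin n) * 0
    ≡⟨ cong (g Fin.zero +_) (*-zeroʳ (length (allFin n))) ⟩
  g Fin.zero + 0
    ≡⟨ +-identityʳ _ ⟩
  g Fin.zero  ∎
sumOver-pick {suc n} (Fin.suc a) g =
  trans (sumOver-allFin-suc (λ i → [ i ≡ᶠ Fin.suc a ] * g i)) (sumOver-pick a (g ∘ Fin.suc))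

-- Resampling one coordinate of a uniform random function

-- Integer form of 𝔼[G (ψ e)] = c · 𝔼[w e · G e] for e uniform in E.  With w = [_≡ᶠ a],
-- ψ = const a and c = |E| it says that conditioning on e = a is the same as setting e to a.
record Resamples (_≈_ : A → A → Set) (E : List A) (c : ℕ) (w : A → ℕ) (ψ : A → A) : Set where
  constructor resamples
  field
    sum-resample : ∀ G → G Preserves _≈_ ⟶ _≡_ →
                   c * (∑[ e ∈ E ] w e * G e) ≡ ∑[ e ∈ E ] G (ψ e)
open Resamples public

pin-resamples : ∀ (a : Fin n) → Resamples _≡_ (allFin n) n [_≡ᶠ a ] (const a)
pin-resamples {n} a = resamples λ G _ → begin
  n * (∑[ i ∈ allFin n ] [ i ≡ᶠ a ] * G i)  ≡⟨ cong (n *_) (sumOver-pick a G) ⟩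
  n * G a                                  ≡⟨ cong (_* G a) (length-tabulate {n = n} id) ⟨
  length (allFin n) * G a                  ≡⟨ sumOver-const (allFin n) (G a) ⟨
  (∑[ i ∈ allFin n ] G a)                  ∎

resamples-invariant : ∀ {_≈_ : A → A → Set} {E c w ψ} → Resamples _≈_ E c w ψ →
                      ∀ G → G Preserves _≈_ ⟶ _≡_ → (∀ e → G (ψ e) ≡ G e) →
                      c * (∑[ e ∈ E ] w e * G e) ≡ ∑[ e ∈ E ] G e
resamples-invariant {E = E} res G G-resp G-inv =
  trans (sum-resample res G G-resp) (sumOver-cong E G-inv)

module _ {_≈_ : A → A → Set} where

  updateAt-preserves : ∀ {m} {ψ : A → A} → ψ Preserves _≈_ ⟶ _≈_ → (j : Fin m) →
                       (λ f → updateAt f j ψ) Preserves Pointwise _≈_ ⟶ Pointwise _≈_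
  updateAt-preserves ψ-resp Fin.zero    f≈f′ Fin.zero    = ψ-resp (f≈f′ Fin.zero)
  updateAt-preserves ψ-resp Fin.zero    f≈f′ (Fin.suc i) = f≈f′ (Fin.suc i)
  updateAt-preserves ψ-resp (Fin.suc j) f≈f′ Fin.zero    = f≈f′ Fin.zero
  updateAt-preserves ψ-resp (Fin.suc j) f≈f′ (Fin.suc i) =
    updateAt-preserves ψ-resp j (f≈f′ ∘ Fin.suc) i

module _ {_≈_ : A → A → Set} (≈-refl : Reflexive _≈_) where

  sumOver-allFuns-suc : ∀ E m (G : Vector A (suc m) → ℕ) → G Preserves Pointwise _≈_ ⟶ _≡_ →
                        sumOver (allFuns (suc m) E) G ≡ ∑[ a ∈ E ] ∑[ f ∈ allFuns m E ] G (a ∷ᶠ f)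
  sumOver-allFuns-suc E m G G-resp =
    trans (sumOver-concatMap _ E G) (sumOver-cong E λ a →
      trans (sumOver-map _ (allFuns m E) G) (sumOver-cong (allFuns m E) λ f →
        G-resp λ { Fin.zero → ≈-refl ; (Fin.suc i) → ≈-refl }))

  updateAt-∷ᶠ-zero : ∀ {m} {ψ : A → A} a (f : Vector A m) →
                     Pointwise _≈_ (ψ a ∷ᶠ f) (updateAt (a ∷ᶠ f) Fin.zero ψ)
  updateAt-∷ᶠ-zero a f Fin.zero    = ≈-refl
  updateAt-∷ᶠ-zero a f (Fin.suc i) = ≈-refl

  updateAt-∷ᶠ-suc : ∀ {m} {ψ : A → A} a (f : Vector A m) j →
                    Pointwise _≈_ (a ∷ᶠ updateAt f j ψ) (updateAt (a ∷ᶠ f) (Fin.suc j) ψ)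
  updateAt-∷ᶠ-suc a f j Fin.zero    = ≈-refl
  updateAt-∷ᶠ-suc a f j (Fin.suc i) = ≈-refl

  resamples-pointwise : ∀ {E c w ψ} → w Preserves _≈_ ⟶ _≡_ → ψ Preserves _≈_ ⟶ _≈_ →
                        Resamples _≈_ E c w ψ → ∀ m (j : Fin m) →
                        Resamples (Pointwise _≈_) (allFuns m E) c (λ f → w (f j)) (λ f → updateAt f j ψ)
  resamples-pointwise {E} {c} {w} {ψ} w-resp ψ-resp res (suc m) Fin.zero =
    resamples λ F F-resp → begin
      c * sumOver (allFuns (suc m) E) (λ f → w (f Fin.zero) * F f)
        ≡⟨ cong (c *_) (sumOver-allFuns-suc E m _ λ f≈f′ →
             cong₂ _*_ (w-resp (f≈f′ Fin.zero)) (F-resp f≈f′)) ⟩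
      c * (∑[ a ∈ E ] ∑[ f ∈ allFuns m E ] w a * F (a ∷ᶠ f))
        ≡⟨ cong (c *_) (sumOver-cong E λ a → *-distribˡ-sumOver (w a) (allFuns m E) _) ⟨
      c * (∑[ a ∈ E ] w a * (∑[ f ∈ allFuns m E ] F (a ∷ᶠ f)))
        ≡⟨ sum-resample res _ (λ a≈a′ → sumOver-cong (allFuns m E) λ f →
             F-resp λ { Fin.zero → a≈a′ ; (Fin.suc i) → ≈-refl }) ⟩
      (∑[ a ∈ E ] ∑[ f ∈ allFuns m E ] F (ψ a ∷ᶠ f))
        ≡⟨ sumOver-cong E (λ a → sumOver-cong (allFuns m E) λ f → F-resp (updateAt-∷ᶠ-zero a f)) ⟩
      (∑[ a ∈ E ] ∑[ f ∈ allFuns m E ] F (updateAt (a ∷ᶠ f) Fin.zero ψ))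
        ≡⟨ sumOver-allFuns-suc E m _ (F-resp ∘ updateAt-preserves {_≈_ = _≈_} ψ-resp Fin.zero) ⟨
      sumOver (allFuns (suc m) E) (λ f → F (updateAt f Fin.zero ψ))  ∎
  resamples-pointwise {E} {c} {w} {ψ} w-resp ψ-resp res (suc m) (Fin.suc j) =
    resamples λ F F-resp → begin
      c * sumOver (allFuns (suc m) E) (λ f → w (f (Fin.suc j)) * F f)
        ≡⟨ cong (c *_) (sumOver-allFuns-suc E m _ λ f≈f′ →
             cong₂ _*_ (w-resp (f≈f′ (Fin.suc j))) (F-resp f≈f′)) ⟩
      c * (∑[ a ∈ E ] ∑[ f ∈ allFuns m E ] w (f j) * F (a ∷ᶠ f))
        ≡⟨ *-distribˡ-sumOver c E _ ⟩
      (∑[ a ∈ E ] c * (∑[ f ∈ allFuns m E ] w (f j) * F (a ∷ᶠ f)))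
        ≡⟨ sumOver-cong E (λ a →
             sum-resample (resamples-pointwise w-resp ψ-resp res m j) (λ f → F (a ∷ᶠ f))
               λ f≈f′ → F-resp λ { Fin.zero → ≈-refl ; (Fin.suc i) → f≈f′ i }) ⟩
      (∑[ a ∈ E ] ∑[ f ∈ allFuns m E ] F (a ∷ᶠ updateAt f j ψ))
        ≡⟨ sumOver-cong E (λ a → sumOver-cong (allFuns m E) λ f → F-resp (updateAt-∷ᶠ-suc a f j)) ⟩
      (∑[ a ∈ E ] ∑[ f ∈ allFuns m E ] F (updateAt (a ∷ᶠ f) (Fin.suc j) ψ))
        ≡⟨ sumOver-allFuns-suc E m _ (F-resp ∘ updateAt-preserves {_≈_ = _≈_} ψ-resp (Fin.suc j)) ⟨
      sumOver (allFuns (suc m) E) (λ f → F (updateAt f (Fin.suc j) ψ))  ∎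

≡ᵇ-true : ∀ {m n} → m ≡ n → (m ≡ᵇ n) ≡ true
≡ᵇ-true {m} {n} = Equivalence.to T-≡ ∘ ≡⇒≡ᵇ m n

≡ᵇ-false : ∀ {m n} → m ≢ n → (m ≡ᵇ n) ≡ false
≡ᵇ-false {m} {n} = dec-false (m ≟ n)

classify-just-low : (i : Fin (2 + k)) → toℕ i < k → classify (just i) ≡ kind-low (suc (toℕ i))
classify-just-low i i<k rewrite ≡ᵇ-false (<⇒≢ (m<n⇒m<1+n i<k)) | ≡ᵇ-false (<⇒≢ i<k) = refl

classify-just-core : (i : Fin (2 + k)) {c : ℕ} → k ≤ toℕ i → classify (just i) ≢ kind-low c
classify-just-core {k} i k≤i with toℕ i ≟ suc k
... | yes i≡d rewrite ≡ᵇ-true i≡d = λ ()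
... | no i≢d rewrite ≡ᵇ-false i≢d
                   | ≡ᵇ-true (≤-antisym (≤-pred (≤∧≢⇒< (≤-pred (toℕ<n i)) i≢d)) k≤i) = λ ()

low⇒¬core : ∀ (σ : State k u n) y {c} → classify (choice σ y) ≡ kind-low c → ¬ T (isCoreᵇ σ y)
low⇒¬core σ y cl with choice σ y
... | nothing = λ ()
... | just i  = λ core → classify-just-core i (≤ᵇ⇒≤ _ (toℕ i) core) cl

¬core⇒low : ∀ (σ : State k u n) y → ¬ T (isCoreᵇ σ y) → ∃[ c ] classify (choice σ y) ≡ kind-low c
¬core⇒low σ y ¬core with choice σ y
... | nothing = 0 , refl
... | just i  = suc (toℕ i) , classify-just-low i (≰⇒> (¬core ∘ ≤⇒≤ᵇ))

idx-d-1-high : k ≤ toℕ (idx-d-1 k)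
idx-d-1-high {k} = ≤-reflexive (sym (trans (toℕ-inject₁ (fromℕ k)) (toℕ-fromℕ k)))

idx-d-high : k ≤ toℕ (idx-d k)
idx-d-high {k} = ≤-trans (n≤1+n k) (≤-reflexive (sym (toℕ-fromℕ (suc k))))

-- Runs under hash families that differ only at h_{d-1}(x) and h_d(x)

-- The 0-based indices i ≥ k are those of h_{d-1} and h_d.
Agree : Fin u → Hash k u n → Hash k u n → Set
Agree {k = k} x h h′ = ∀ i y → y ≢ x ⊎ toℕ i < k → h i y ≡ h′ i y

firstFree-low : ∀ (g : Hash k u n) σ y c js {j} → firstFree g σ y c js ≡ just j → toℕ j < k
firstFree-low g σ y c [] ()
firstFree-low {k = k} g σ y c (j′ ∷ js) found
  with c ≤ᵇ toℕ j′ | toℕ j′ <ᵇ k in j′<k | table σ (g j′ y)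
... | true  | true  | nothing =
  subst (λ j → toℕ j < k) (just-injective found) (<ᵇ⇒< _ _ (subst T (sym j′<k) _))
... | true  | true  | just _  = firstFree-low g σ y c js found
... | true  | false | _       = firstFree-low g σ y c js found
... | false | _     | _       = firstFree-low g σ y c js found

module _ {u : ℕ} (L : ℕ) (x : Fin u) where

  Core : State k u n → Set
  Core σ = T (isCoreᵇ σ x)

  CoreOutcome : Outcome k u n → Set
  CoreOutcome = Core ∘ stateOf

  put-Core : ∀ (σ : State k u n) y s i → (y ≡ x → k ≤ toℕ i) → (y ≢ x → Core σ) →
             Core (put σ y s i)
  put-Core σ y s i high other with x ≟ᶠ y
  ... | yes refl = ≤⇒≤ᵇ (high refl)
  ... | no x≢y   = other (x≢y ∘ sym)

  put-high-Core : ∀ (σ : State k u n) y s {i} → k ≤ toℕ i → Core σ → Core (put σ y s i)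
  put-high-Core σ y s k≤i core = put-Core σ y s _ (const k≤i) (const core)

  mutual
    replace-preserves-Core : ∀ fuel (g : Hash k u n) σ y cnt → Core σ →
                             CoreOutcome (replace L fuel g σ y cnt)
    replace-preserves-Core zero g σ y cnt core = core
    replace-preserves-Core {k = k} (suc f) g σ y cnt core with classify {k} (choice σ y) in cl
    ... | kind-d   = moveCore-preserves-Core f g σ y (idx-d-1 k) cnt idx-d-1-high core
    ... | kind-d-1 = moveCore-preserves-Core f g σ y (idx-d k) cnt idx-d-high core
    ... | kind-low c with firstFree g σ y c (allFin (2 + k))
    ...   | just j  =
      put-Core σ y (g j y) j (λ { refl → contradiction core (low⇒¬core σ x cl) }) (const core)
    ...   | nothing with table σ (g (idx-d-1 k) y)
    ...     | nothing = put-high-Core σ y (g (idx-d-1 k) y) idx-d-1-high core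
    ...     | just z  =
      replace-preserves-Core f g _ z 0 (put-high-Core σ y (g (idx-d-1 k) y) idx-d-1-high core)

    moveCore-preserves-Core : ∀ fuel (g : Hash k u n) σ y i cnt → k ≤ toℕ i → Core σ →
                              CoreOutcome (moveCore L fuel g σ y i cnt)
    moveCore-preserves-Core f g σ y i cnt k≤i core with table σ (g i y)
    ... | nothing = put-high-Core σ y (g i y) k≤i core
    ... | just z with L ≤ᵇ suc cnt
    ...   | true  = put-high-Core σ y (g i y) k≤i core
    ...   | false = replace-preserves-Core f g _ z (suc cnt) (put-high-Core σ y (g i y) k≤i core)

  insertFrom-preserves-Core : ∀ (g : Hash k u n) o ys → CoreOutcome o →
                              CoreOutcome (insertFrom L g o ys)
  insertFrom-preserves-Core g (fail σ) ys       core = core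
  insertFrom-preserves-Core g (ok σ)   []       core = core
  insertFrom-preserves-Core g (ok σ)   (y ∷ ys) core =
    insertFrom-preserves-Core g (insertOne L g σ y) ys
      (replace-preserves-Core (suc (suc u * suc (suc L))) g σ y 0 core)

  put-x-Core : ∀ (g : Hash k u n) σ → Core (put σ x (g (idx-d-1 k) x) (idx-d-1 k))
  put-x-Core {k = k} g σ =
    put-Core σ x (g (idx-d-1 k) x) (idx-d-1 k) (const idx-d-1-high) (contradiction refl)

  evict-x-Core : ∀ fuel (g : Hash k u n) σ z →
                 CoreOutcome (replace L fuel g (put σ x (g (idx-d-1 k) x) (idx-d-1 k)) z 0)
  evict-x-Core fuel g σ z = replace-preserves-Core fuel g _ z 0 (put-x-Core g σ)

  nonLow≢x : ∀ (σ : State k u n) y {K} → ¬ Core σ → classify (choice σ y) ≡ K →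
             (∀ {c} → K ≢ kind-low c) → y ≢ x
  nonLow≢x σ y ¬core cl K≢low refl =
    let c , cl′ = ¬core⇒low σ x ¬core in K≢low (trans (sym cl) cl′)

  module _ {h h′ : Hash k u n} (agree : Agree x h h′) where

    SameUntilCore : Outcome k u n → Outcome k u n → Set
    SameUntilCore o o′ = o ≡ o′ ⊎ CoreOutcome o × CoreOutcome o′

    firstFree-agree : ∀ σ y c js → firstFree h σ y c js ≡ firstFree h′ σ y c js
    firstFree-agree σ y c [] = refl
    firstFree-agree σ y c (j ∷ js) with c ≤ᵇ toℕ j | toℕ j <ᵇ k in j<k
    ... | false | _     = firstFree-agree σ y c js
    ... | true  | false = firstFree-agree σ y c js
    ... | true  | true rewrite agree j y (inj₂ (<ᵇ⇒< _ _ (subst T (sym j<k) _)))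
                       with table σ (h′ j y)
    ...   | nothing = refl
    ...   | just _  = firstFree-agree σ y c js

    mutual
      replace-sim : ∀ fuel σ y cnt →
                    SameUntilCore (replace L fuel h σ y cnt) (replace L fuel h′ σ y cnt)
      replace-sim zero σ y cnt = inj₁ refl
      replace-sim (suc f) σ y cnt with isCoreᵇ σ x in isCore
      ... | true  = inj₂ (replace-preserves-Core (suc f) h σ y cnt core ,
                          replace-preserves-Core (suc f) h′ σ y cnt core)
        where core = subst T (sym isCore) _
      ... | false with classify {k} (choice σ y) in cl
      ...   | kind-d   = moveCore-sim f σ y (idx-d-1 k) cnt
                           (agree _ y (inj₁ (nonLow≢x σ y (subst T isCore) cl λ ())))
      ...   | kind-d-1 = moveCore-sim f σ y (idx-d k) cnt
                           (agree _ y (inj₁ (nonLow≢x σ y (subst T isCore) cl λ ())))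
      ...   | kind-low c with firstFree h σ y c (allFin (2 + k)) in found
                            | firstFree h′ σ y c (allFin (2 + k))
                            | firstFree-agree σ y c (allFin (2 + k))
      ...     | just j  | .(just j) | refl =
        inj₁ (cong (λ s → ok (put σ y s j)) (agree j y (inj₂ (firstFree-low h σ y c _ found))))
      ...     | nothing | .nothing  | refl with y ≟ᶠ x
      ...       | no y≢x with table σ (h (idx-d-1 k) y) | table σ (h′ (idx-d-1 k) y)
                            | cong (table σ) (agree (idx-d-1 k) y (inj₁ y≢x))
      ...         | nothing | .nothing  | refl =
        inj₁ (cong (λ s → ok (put σ y s (idx-d-1 k))) (agree _ y (inj₁ y≢x)))
      ...         | just z  | .(just z) | refl = evict-sim f σ y (idx-d-1 k) z 0 (agree _ y (inj₁ y≢x))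
      replace-sim (suc f) σ x cnt | false | kind-low c | nothing | .nothing | refl | yes refl
        with table σ (h (idx-d-1 k) x) | table σ (h′ (idx-d-1 k) x)
      ... | nothing | nothing = inj₂ (put-x-Core h σ , put-x-Core h′ σ)
      ... | nothing | just z′ = inj₂ (put-x-Core h σ , evict-x-Core f h′ σ z′)
      ... | just z  | nothing = inj₂ (evict-x-Core f h σ z , put-x-Core h′ σ)
      ... | just z  | just z′ = inj₂ (evict-x-Core f h σ z , evict-x-Core f h′ σ z′)

      moveCore-sim : ∀ fuel σ y i cnt → h i y ≡ h′ i y →
                     SameUntilCore (moveCore L fuel h σ y i cnt) (moveCore L fuel h′ σ y i cnt)
      moveCore-sim f σ y i cnt same with table σ (h i y) | table σ (h′ i y) | cong (table σ) same
      ... | nothing | .nothing  | refl = inj₁ (cong (λ s → ok (put σ y s i)) same)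
      ... | just z  | .(just z) | refl with L ≤ᵇ suc cnt
      ...   | true  = inj₁ (cong (λ s → fail (put σ y s i)) same)
      ...   | false = evict-sim f σ y i z (suc cnt) same

      evict-sim : ∀ fuel σ y i z cnt → h i y ≡ h′ i y →
                  SameUntilCore (replace L fuel h (put σ y (h i y) i) z cnt)
                                (replace L fuel h′ (put σ y (h′ i y) i) z cnt)
      evict-sim f σ y i z cnt same rewrite same = replace-sim f _ z cnt

    insertFrom-sim : ∀ o o′ ys → SameUntilCore o o′ →
                     isCoreᵇ (stateOf (insertFrom L h o ys)) x ≡ isCoreᵇ (stateOf (insertFrom L h′ o′ ys)) x
    insertFrom-sim o o′ ys (inj₂ (core , core′)) =
      trans (Equivalence.to T-≡ (insertFrom-preserves-Core h o ys core))
            (sym (Equivalence.to T-≡ (insertFrom-preserves-Core h′ o′ ys core′)))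
    insertFrom-sim (fail σ) _ ys       (inj₁ refl) = refl
    insertFrom-sim (ok σ)   _ []       (inj₁ refl) = refl
    insertFrom-sim (ok σ)   _ (y ∷ ys) (inj₁ refl) =
      insertFrom-sim _ _ ys (replace-sim (suc (suc u * suc (suc L))) σ y 0)

coreEvent-agree : ∀ L xs (x : Fin u) {h h′ : Hash k u n} → Agree x h h′ →
                  coreEvent k u n L xs x h ≡ coreEvent k u n L xs x h′
coreEvent-agree L xs x agree =
  insertFrom-sim L x agree (ok emptyState) (ok emptyState) xs (inj₁ refl)

-- Counting hash families

infixl 6 _[_,_]≔_
_[_,_]≔_ : Hash k u n → Fin (2 + k) → Fin u → Fin n → Hash k u n
h [ i , y ]≔ v = updateAt h i (λ g → updateAt g y (const v))

hash-resamples : ∀ (i : Fin (2 + k)) (x : Fin u) (a : Fin n) →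
                 Resamples (Pointwise (Pointwise _≡_)) (allHash k u n) n
                           (λ h → [ h i x ≡ᶠ a ]) (λ h → h [ i , x ]≔ a)
hash-resamples {k} {u} {n} i x a =
  resamples-pointwise {_≈_ = Pointwise _≡_} (λ _ → refl) {E = allFuns u (allFin n)} {n}
    {λ g → [ g x ≡ᶠ a ]} {λ g → updateAt g x (const a)}
    (λ g≈g′ → cong [_≡ᶠ a ] (g≈g′ x)) (updateAt-preserves {_≈_ = _≡_} {ψ = const a} (λ _ → refl) x)
    column-resamples (2 + k) i
  where
  column-resamples : Resamples (Pointwise _≡_) (allFuns u (allFin n)) n
                               (λ g → [ g x ≡ᶠ a ]) (λ g → updateAt g x (const a))
  column-resamples = resamples-pointwise {_≈_ = _≡_} refl {E = allFin n} {n} {[_≡ᶠ a ]} {const a}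
                       (cong [_≡ᶠ a ]) (λ _ → refl) (pin-resamples a) u x

Agree-≔ : ∀ (h : Hash k u n) {i} x v → k ≤ toℕ i → Agree x h (h [ i , x ]≔ v)
Agree-≔ h {i} x v k≤i j y off with j ≟ᶠ i
... | no j≢i = sym (cong-app (updateAt-minimal j i h j≢i) y)
... | yes refl with y ≟ᶠ x
...   | no y≢x   = sym (trans (cong-app (updateAt-updates i h) y) (updateAt-minimal y x (h i) y≢x))
...   | yes refl = ⊥-elim ([ contradiction refl , flip <⇒≱ k≤i ]′ off)

indicator-∧-rotate : ∀ c p q → indicator (c ∧ (p ∧ q)) ≡ indicator p * (indicator q * indicator c)
indicator-∧-rotate c p q = begin
  indicator (c ∧ (p ∧ q))                    ≡⟨ indicator-∧ c (p ∧ q) ⟩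
  indicator c * indicator (p ∧ q)            ≡⟨ cong (indicator c *_) (indicator-∧ p q) ⟩
  indicator c * (indicator p * indicator q)  ≡⟨ *-comm (indicator c) _ ⟩
  indicator p * indicator q * indicator c    ≡⟨ *-assoc (indicator p) _ _ ⟩
  indicator p * (indicator q * indicator c)  ∎

count-pairEvent : ∀ (x : Fin u) (a b : Fin n) (C : Hash k u n → Bool) →
                  (∀ {h h′} → Agree x h h′ → C h ≡ C h′) →
                  n * n * count k u n (λ h → C h ∧ pairEvent k u n x a b h) ≡ count k u n C
count-pairEvent {u} {n} {k} x a b C C-agree = begin
  n * n * count k u n (λ h → C h ∧ pairEvent k u n x a b h)
    ≡⟨ cong (n * n *_) (length-filterᵇ _ H) ⟩
  n * n * (∑[ h ∈ H ] indicator (C h ∧ pairEvent k u n x a b h))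
    ≡⟨ *-assoc n n _ ⟩
  n * (n * (∑[ h ∈ H ] indicator (C h ∧ pairEvent k u n x a b h)))
    ≡⟨ cong (λ s → n * (n * s)) (sumOver-cong H λ h →
         indicator-∧-rotate (C h) (eqFᵇ (h d-1 x) a) (eqFᵇ (h d x) b)) ⟩
  n * (n * (∑[ h ∈ H ] [ h d-1 x ≡ᶠ a ] * ([ h d x ≡ᶠ b ] * indicator (C h))))
    ≡⟨ cong (n *_) (resamples-invariant (hash-resamples d-1 x a) _
         (λ h≈h′ → cong₂ _*_ (cong [_≡ᶠ b ] (h≈h′ d x)) (C-resp h≈h′)) invariant-d-1) ⟩
  n * (∑[ h ∈ H ] [ h d x ≡ᶠ b ] * indicator (C h))
    ≡⟨ resamples-invariant (hash-resamples d x b) _ C-resp invariant-d ⟩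
  (∑[ h ∈ H ] indicator (C h))
    ≡⟨ length-filterᵇ C H ⟨
  count k u n C  ∎
  where
  H = allHash k u n
  d-1 = idx-d-1 k
  d = idx-d k

  C-resp : (indicator ∘ C) Preserves Pointwise (Pointwise _≡_) ⟶ _≡_
  C-resp h≈h′ = cong indicator (C-agree λ i y _ → h≈h′ i y)

  invariant-d-1 : ∀ h → [ (h [ d-1 , x ]≔ a) d x ≡ᶠ b ] * indicator (C (h [ d-1 , x ]≔ a))
                        ≡ [ h d x ≡ᶠ b ] * indicator (C h)
  invariant-d-1 h =
    cong₂ _*_ (cong [_≡ᶠ b ] (cong-app (updateAt-minimal d d-1 h fromℕ≢inject₁) x))
              (cong indicator (sym (C-agree (Agree-≔ h x a idx-d-1-high))))

  invariant-d : ∀ h → indicator (C (h [ d , x ]≔ b)) ≡ indicator (C h)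
  invariant-d h = cong indicator (sym (C-agree (Agree-≔ h x b idx-d-high)))

lemma9 : (k u n L : ℕ) (xs : List (Fin u)) → Unique xs → (x : Fin u) → (a b : Fin n) →
    count k u n (λ h → coreEvent k u n L xs x h ∧ pairEvent k u n x a b h) * count k u n (λ _ → true)
      ≡ count k u n (coreEvent k u n L xs x) * count k u n (pairEvent k u n x a b)
lemma9 k u n L xs _ x a b = begin
  X * count k u n (λ _ → true)  ≡⟨ cong (X *_) (count-pairEvent x a b (λ _ → true) (λ _ → refl)) ⟨
  X * (n * n * Y)               ≡⟨ *-assoc X (n * n) Y ⟨
  X * (n * n) * Y               ≡⟨ cong (_* Y) (*-comm X (n * n)) ⟩
  n * n * X * Y                 ≡⟨ cong (_* Y) (count-pairEvent x a b core (coreEvent-agree L xs x)) ⟩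
  count k u n core * Y          ∎
  where
  core = coreEvent k u n L xs x
  X = count k u n (λ h → core h ∧ pairEvent k u n x a b h)
  Y = count k u n (pairEvent k u n x a b)
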